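{- Let $\sigma,\omega\in S_\infty$ with $\sigma<_{\mathrm{Bruhat}}\omega$ and $\sigma\not\approx\omega$. Then the poset $([\sigma,\omega]^f,<_{\mathrm{Bruhat}})$ has no maximal element.
   Context: $S_\infty$ is the group of bijections $\mathbb N\to\mathbb N$, with the Bruhat order: $\sigma\le_{\mathrm{Bruhat}}\omega$ iff for every $n$, the $i$-th smallest element of $\{\sigma(1),\dots,\sigma(n)\}$ is at most the $i$-th smallest of $\{\omega(1),\dots,\omega(n)\}$ for all $i$. $\sigma\approx\nu$ means $\sigma(n)\ne\nu(n)$ for only finitely many $n$. $[\sigma,\omega]^f=\{\nu:\sigma\le_{\mathrm{Bruhat}}\nu\le_{\mathrm{Bruhat}}\omega,\ \nu\approx\sigma\}$. -}

module Defs where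

open import Data.Nat using (ℕ; _≤_)
open import Data.Nat.Properties using (≤-decTotalOrder)
open import Data.List using (List; map; upTo)
open import Data.List.Relation.Binary.Pointwise using (Pointwise)
open import Data.List.Sort ≤-decTotalOrder using (sort)
open import Data.Product using (Σ; ∃; _×_)
open import Function.Bundles using (Bijection; _⤖_)
open import Relation.Binary.PropositionalEquality using (_≡_)
open import Relation.Nullary using (¬_)

-- S∞ : bijections ℕ → ℕ  (we index from 0 instead of 1; immaterial)
S∞ : Set
S∞ = ℕ ⤖ ℕ

app : S∞ → ℕ → ℕ
app σ = Bijection.to σ

sortedPrefix : S∞ → ℕ → List ℕ
sortedPrefix σ n = sort (map (app σ) (upTo n))

_≤B_ : S∞ → S∞ → Set
σ ≤B ω = ∀ n → Pointwise _≤_ (sortedPrefix σ n) (sortedPrefix ω n)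

_≐_ : S∞ → S∞ → Set
σ ≐ ω = ∀ n → app σ n ≡ app ω n

_<B_ : S∞ → S∞ → Set
σ <B ω = σ ≤B ω × ¬ (σ ≐ ω)

-- σ ≈ ν : σ(n) ≠ ν(n) for only finitely many n, i.e. they agree from some point on
_≈∞_ : S∞ → S∞ → Set
σ ≈∞ ν = Σ ℕ λ N → ∀ n → N ≤ n → app σ n ≡ app ν n

_∈[_,_]ᶠ : S∞ → S∞ → S∞ → Set
ν ∈[ σ , ω ]ᶠ = σ ≤B ν × ν ≤B ω × σ ≈∞ ν

IsMaximalIn : S∞ → S∞ → S∞ → Set
IsMaximalIn σ ω ν = ν ∈[ σ , ω ]ᶠ × (∀ μ → μ ∈[ σ , ω ]ᶠ → ¬ (ν <B μ))

{-# OPTIONS --safe #-}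
-- Let rank f n k be the number of i < n with k ≤ f i. Comparing sorted prefixes entrywise is the
-- same as comparing these counts, so σ ≤B ω iff rank σ n k ≤ rank ω n k for all n, k.
--
-- Let ν ∈ [σ,ω]^f. As ν ≈ σ and σ ≉ ω, ν ≠ ω; let a be the first position where they differ.
-- Then ν a < ω a, and ω a = ν p for some p > a. Let b be the first position after a with
-- ν a < ν b ≤ ω a and put μ = ν ∘ (a b). Swapping an increasing pair goes up in the Bruhat
-- order, and μ ≈ ν. Moreover μ ≤B ω: the only ranks that grow (by one) are rank · n k with
-- a < n ≤ b and ν a < k ≤ ν b, and for those, counting the values in [k, ω a] (ω takes one at a,
-- ν takes none at positions a, …, n - 1) gives rank ν n k < rank ω n k. So μ ∈ [σ,ω]^f lies
-- strictly above ν.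
module Submission where

open import Defs
open import Data.Product using (∃; _×_; _,_; proj₁; proj₂)
open import Relation.Nullary using (¬_; ¬?; yes; no; contradiction)

open import Data.Nat.Properties
open import Algebra.Properties.CommutativeSemigroup +-commutativeSemigroup
  using (xy∙z≈xz∙y; interchange)
open import Data.List using (List; []; _∷_; _++_; [_]; _∷ʳ_; map; upTo; length)
open import Data.List.Properties using (map-++; upTo-∷ʳ; length-map; length-upTo)
open import Data.List.Relation.Binary.Permutation.Propositional using (_↭_)
open import Data.List.Relation.Binary.Permutation.Propositional.Properties using (map⁺; ↭-length)
open import Data.List.Relation.Binary.Pointwise using (Pointwise; []; _∷_; transitive)
open import Data.List.Relation.Unary.All as All using (All; []; _∷_)
open import Data.List.Relation.Unary.AllPairs using (AllPairs; []; _∷_)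
open import Data.List.Relation.Unary.Linked.Properties using (Linked⇒AllPairs)
open import Data.List.Sort ≤-decTotalOrder using (sort-↭; sort-↗)
open import Data.Nat using (ℕ; zero; suc; _+_; _≤_; _<_; _≤?_; _<?_; _≟_; z≤n; s≤s; _⊔_)
open import Data.Nat.Induction using (<-rec)
open import Data.Nat.ListAction using (sum)
open import Data.Nat.ListAction.Properties using (sum-↭; sum-++)
open import Data.Sum using (_⊎_; inj₁; inj₂)
open import Function using (_∘_)
open import Function.Bundles using (Bijection; mk↔ₛ′)
open import Function.Construct.Composition using (_⤖-∘_)
open import Function.Properties.Inverse using (↔⇒⤖)
open import Relation.Binary.Definitions using (tri<; tri≈; tri>)
open import Relation.Binary.PropositionalEquality
  using (_≡_; _≢_; refl; sym; trans; cong; cong₂; subst; subst₂; module ≡-Reasoning)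
open import Relation.Nullary.Decidable using (decidable-stable; _×-dec_)
open import Relation.Unary using (Pred; Decidable)

variable
  a b i k l n x y : ℕ
  f g : ℕ → ℕ
  xs ys : List ℕ

𝟙[_≤_] : ℕ → ℕ → ℕ
𝟙[ k ≤ x ] with k ≤? x
... | yes _ = 1
... | no  _ = 0

𝟙-yes : k ≤ x → 𝟙[ k ≤ x ] ≡ 1
𝟙-yes {k} {x} k≤x with k ≤? x
... | yes _  = refl
... | no k≰x = contradiction k≤x k≰x

𝟙-no : x < k → 𝟙[ k ≤ x ] ≡ 0
𝟙-no {x} {k} x<k with k ≤? x
... | yes k≤x = contradiction k≤x (<⇒≱ x<k)
... | no _    = refl

𝟙≤1 : 𝟙[ k ≤ x ] ≤ 1
𝟙≤1 {k} {x} with k ≤? x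
... | yes _ = ≤-refl
... | no  _ = z≤n

𝟙-mono : (k ≤ x → l ≤ y) → 𝟙[ k ≤ x ] ≤ 𝟙[ l ≤ y ]
𝟙-mono {k} {x} k≤x⇒l≤y with k ≤? x
... | yes k≤x = ≤-reflexive (sym (𝟙-yes (k≤x⇒l≤y k≤x)))
... | no  _   = z≤n

count≥ : ℕ → List ℕ → ℕ
count≥ k xs = sum (map (λ x → 𝟙[ k ≤ x ]) xs)

count≥-↭ : xs ↭ ys → count≥ k xs ≡ count≥ k ys
count≥-↭ xs↭ys = sum-↭ (map⁺ _ xs↭ys)

count≥-++ : ∀ xs ys → count≥ k (xs ++ ys) ≡ count≥ k xs + count≥ k ys
count≥-++ {k} xs ys = trans (cong sum (map-++ _ xs ys)) (sum-++ (map (λ x → 𝟙[ k ≤ x ]) xs) _)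

count≥≤length : ∀ xs → count≥ k xs ≤ length xs
count≥≤length []       = z≤n
count≥≤length (x ∷ xs) = +-mono-≤ 𝟙≤1 (count≥≤length xs)

count≥-all : All (k ≤_) xs → count≥ k xs ≡ length xs
count≥-all []           = refl
count≥-all (k≤x ∷ k≤xs) = cong₂ _+_ (𝟙-yes k≤x) (count≥-all k≤xs)

count≥-mono : Pointwise _≤_ xs ys → count≥ k xs ≤ count≥ k ys
count≥-mono []             = z≤n
count≥-mono (x≤y ∷ xs≤ys) = +-mono-≤ (𝟙-mono (λ k≤x → ≤-trans k≤x x≤y)) (count≥-mono xs≤ys)

count≥⇒Pointwise : AllPairs _≤_ xs → AllPairs _≤_ ys → length xs ≡ length ys →
                   (∀ k → count≥ k xs ≤ count≥ k ys) → Pointwise _≤_ xs ys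
count≥⇒Pointwise {[]}     {[]}     _ _ _ _ = []
count≥⇒Pointwise {x ∷ xs} {y ∷ ys} (x≤xs ∷ xs↗) (y≤ys ∷ ys↗) |x∷xs|≡|y∷ys| counts =
  x≤y ∷ count≥⇒Pointwise xs↗ ys↗ |xs|≡|ys| tail-counts
  where
  open ≤-Reasoning
  |xs|≡|ys| : length xs ≡ length ys
  |xs|≡|ys| = suc-injective |x∷xs|≡|y∷ys|

  x≤y : x ≤ y
  x≤y with x ≤? y
  ... | yes x≤y = x≤y
  ... | no  x≰y = contradiction (begin
    suc (length xs)            ≡⟨ count≥-all (≤-refl ∷ x≤xs) ⟨
    count≥ x (x ∷ xs)          ≤⟨ counts x ⟩
    𝟙[ x ≤ y ] + count≥ x ys   ≡⟨ cong (_+ count≥ x ys) (𝟙-no (≰⇒> x≰y)) ⟩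
    count≥ x ys                ≤⟨ count≥≤length ys ⟩
    length ys                  ≡⟨ |xs|≡|ys| ⟨
    length xs                  ∎) 1+n≰n

  tail-counts : ∀ k → count≥ k xs ≤ count≥ k ys
  tail-counts k with k ≤? y
  ... | yes k≤y = begin
    count≥ k xs  ≤⟨ count≥≤length xs ⟩
    length xs    ≡⟨ |xs|≡|ys| ⟩
    length ys    ≡⟨ count≥-all (All.map (≤-trans k≤y) y≤ys) ⟨
    count≥ k ys  ∎
  ... | no  k≰y = subst₂ _≤_ (cong (_+ count≥ k xs) (𝟙-no (≤-<-trans x≤y y<k)))
                             (cong (_+ count≥ k ys) (𝟙-no y<k)) (counts k)
    where
    y<k : y < k
    y<k = ≰⇒> k≰y

rank : (ℕ → ℕ) → ℕ → ℕ → ℕ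
rank f zero    k = 0
rank f (suc n) k = rank f n k + 𝟙[ k ≤ f n ]

count≥-prefix : ∀ f n → count≥ k (map f (upTo n)) ≡ rank f n k
count≥-prefix         f zero    = refl
count≥-prefix {k = k} f (suc n) = begin
  count≥ k (map f (upTo (suc n)))             ≡⟨ cong (count≥ k ∘ map f) (upTo-∷ʳ n) ⟨
  count≥ k (map f (upTo n ∷ʳ n))              ≡⟨ cong (count≥ k) (map-++ f (upTo n) [ n ]) ⟩
  count≥ k (map f (upTo n) ++ [ f n ])        ≡⟨ count≥-++ (map f (upTo n)) [ f n ] ⟩
  count≥ k (map f (upTo n)) + (𝟙[ k ≤ f n ] + 0) ≡⟨ cong₂ _+_ (count≥-prefix f n) (+-identityʳ _) ⟩
  rank f (suc n) k                            ∎
  where open ≡-Reasoning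

_≼_ : (ℕ → ℕ) → (ℕ → ℕ) → Set
f ≼ g = ∀ n k → rank f n k ≤ rank g n k

count≥-sortedPrefix : ∀ σ n → count≥ k (sortedPrefix σ n) ≡ rank (app σ) n k
count≥-sortedPrefix σ n = trans (count≥-↭ (sort-↭ _)) (count≥-prefix (app σ) n)

length-sortedPrefix : ∀ σ n → length (sortedPrefix σ n) ≡ n
length-sortedPrefix σ n = trans (↭-length (sort-↭ _)) (trans (length-map (app σ) (upTo n)) (length-upTo n))

≤B⇒≼ : ∀ {σ ω} → σ ≤B ω → app σ ≼ app ω
≤B⇒≼ {σ} {ω} σ≤ω n k = subst₂ _≤_ (count≥-sortedPrefix σ n) (count≥-sortedPrefix ω n) (count≥-mono (σ≤ω n))

≼⇒≤B : ∀ {σ ω} → app σ ≼ app ω → σ ≤B ω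
≼⇒≤B {σ} {ω} σ≼ω n = count≥⇒Pointwise (sorted σ) (sorted ω)
  (trans (length-sortedPrefix σ n) (sym (length-sortedPrefix ω n)))
  (λ k → subst₂ _≤_ (sym (count≥-sortedPrefix σ n)) (sym (count≥-sortedPrefix ω n)) (σ≼ω n k))
  where
  sorted : ∀ τ → AllPairs _≤_ (sortedPrefix τ n)
  sorted τ = Linked⇒AllPairs ≤-trans (sort-↗ _)

rank-cong : (∀ {i} → i < n → f i ≡ g i) → rank f n k ≡ rank g n k
rank-cong {zero}          _   = refl
rank-cong {suc n} {k = k} f≗g =
  cong₂ _+_ (rank-cong (f≗g ∘ m<n⇒m<1+n)) (cong (λ v → 𝟙[ k ≤ v ]) (f≗g ≤-refl))

transpose : ℕ → ℕ → ℕ → ℕ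
transpose a b i with i ≟ a
... | yes _ = b
... | no  _ with i ≟ b
...   | yes _ = a
...   | no  _ = i

transpose-ˡ : ∀ a b → transpose a b a ≡ b
transpose-ˡ a b with a ≟ a
... | yes _   = refl
... | no  a≢a = contradiction refl a≢a

transpose-ʳ : ∀ a b → transpose a b b ≡ a
transpose-ʳ a b with b ≟ a
... | yes b≡a = b≡a
... | no  _ with b ≟ b
...   | yes _   = refl
...   | no  b≢b = contradiction refl b≢b

transpose-≢ : i ≢ a → i ≢ b → transpose a b i ≡ i
transpose-≢ {i} {a} {b} i≢a i≢b with i ≟ a
... | yes i≡a = contradiction i≡a i≢a
... | no  _ with i ≟ b
...   | yes i≡b = contradiction i≡b i≢b
...   | no  _   = refl

transpose-involutive : ∀ a b i → transpose a b (transpose a b i) ≡ i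
transpose-involutive a b i with i ≟ a
... | yes refl = transpose-ʳ a b
... | no  i≢a with i ≟ b
...   | yes refl = transpose-ˡ a b
...   | no  i≢b  = transpose-≢ i≢a i≢b

transposition : ℕ → ℕ → S∞
transposition a b = ↔⇒⤖ (mk↔ₛ′ (transpose a b) (transpose a b)
  (transpose-involutive a b) (transpose-involutive a b))

_∘⟨_⇄_⟩ : S∞ → ℕ → ℕ → S∞
ν ∘⟨ a ⇄ b ⟩ = ν ⤖-∘ transposition a b

position : ∀ a b n → n ≤ a ⊎ (a < n × n ≤ b) ⊎ b < n
position a b n with n ≤? a | n ≤? b
... | yes n≤a | _       = inj₁ n≤a
... | no  n≰a | yes n≤b = inj₂ (inj₁ (≰⇒> n≰a , n≤b))
... | no  _   | no  n≰b = inj₂ (inj₂ (≰⇒> n≰b))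

module _ (f : ℕ → ℕ) {a b : ℕ} (a<b : a < b) where

  private
    τ : ℕ → ℕ
    τ = transpose a b

  rank-transpose-below : n ≤ a → rank (f ∘ τ) n k ≡ rank f n k
  rank-transpose-below n≤a = rank-cong λ i<n →
    cong f (transpose-≢ (<⇒≢ (<-≤-trans i<n n≤a)) (<⇒≢ (<-trans (<-≤-trans i<n n≤a) a<b)))

  rank-transpose-between : a < n → n ≤ b →
                           rank (f ∘ τ) n k + 𝟙[ k ≤ f a ] ≡ rank f n k + 𝟙[ k ≤ f b ]
  rank-transpose-between {suc n} {k} (s≤s a≤n) 1+n≤b with m≤n⇒m<n∨m≡n a≤n
  ... | inj₂ refl = begin
    rank (f ∘ τ) a k + 𝟙[ k ≤ f (τ a) ] + 𝟙[ k ≤ f a ]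
      ≡⟨ cong₂ (λ r t → r + 𝟙[ k ≤ f t ] + 𝟙[ k ≤ f a ]) (rank-transpose-below ≤-refl) (transpose-ˡ a b) ⟩
    rank f a k + 𝟙[ k ≤ f b ] + 𝟙[ k ≤ f a ]  ≡⟨ xy∙z≈xz∙y (rank f a k) _ 𝟙[ k ≤ f a ] ⟩
    rank f a k + 𝟙[ k ≤ f a ] + 𝟙[ k ≤ f b ]  ∎
    where open ≡-Reasoning
  ... | inj₁ a<n = begin
    rank (f ∘ τ) n k + 𝟙[ k ≤ f (τ n) ] + 𝟙[ k ≤ f a ]
      ≡⟨ cong (λ t → rank (f ∘ τ) n k + 𝟙[ k ≤ f t ] + 𝟙[ k ≤ f a ]) (transpose-≢ (>⇒≢ a<n) (<⇒≢ 1+n≤b)) ⟩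
    rank (f ∘ τ) n k + 𝟙[ k ≤ f n ] + 𝟙[ k ≤ f a ]  ≡⟨ xy∙z≈xz∙y (rank (f ∘ τ) n k) 𝟙[ k ≤ f n ] _ ⟩
    rank (f ∘ τ) n k + 𝟙[ k ≤ f a ] + 𝟙[ k ≤ f n ]
      ≡⟨ cong (_+ 𝟙[ k ≤ f n ]) (rank-transpose-between a<n (<⇒≤ 1+n≤b)) ⟩
    rank f n k + 𝟙[ k ≤ f b ] + 𝟙[ k ≤ f n ]        ≡⟨ xy∙z≈xz∙y (rank f n k) 𝟙[ k ≤ f b ] _ ⟩
    rank f n k + 𝟙[ k ≤ f n ] + 𝟙[ k ≤ f b ]        ∎
    where open ≡-Reasoning

  rank-transpose-above : b < n → rank (f ∘ τ) n k ≡ rank f n k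
  rank-transpose-above {suc n} {k} (s≤s b≤n) with m≤n⇒m<n∨m≡n b≤n
  ... | inj₂ refl = trans (cong (λ t → rank (f ∘ τ) b k + 𝟙[ k ≤ f t ]) (transpose-ʳ a b))
                          (rank-transpose-between a<b ≤-refl)
  ... | inj₁ b<n  = cong₂ _+_ (rank-transpose-above b<n)
    (cong (λ t → 𝟙[ k ≤ f t ]) (transpose-≢ (>⇒≢ (<-trans a<b b<n)) (>⇒≢ b<n)))

  rank-transpose-between-≡ : a < n → n ≤ b → 𝟙[ k ≤ f a ] ≡ 𝟙[ k ≤ f b ] →
                             rank (f ∘ τ) n k ≡ rank f n k
  rank-transpose-between-≡ {n} {k} a<n n≤b same = +-cancelʳ-≡ 𝟙[ k ≤ f b ] _ _
    (trans (cong (rank (f ∘ τ) n k +_) (sym same)) (rank-transpose-between a<n n≤b))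

  rank-transpose-between-suc : a < n → n ≤ b → f a < k → k ≤ f b →
                               rank (f ∘ τ) n k ≡ suc (rank f n k)
  rank-transpose-between-suc {n} {k} a<n n≤b fa<k k≤fb = begin
    rank (f ∘ τ) n k                   ≡⟨ +-identityʳ _ ⟨
    rank (f ∘ τ) n k + 0               ≡⟨ cong (rank (f ∘ τ) n k +_) (𝟙-no fa<k) ⟨
    rank (f ∘ τ) n k + 𝟙[ k ≤ f a ]    ≡⟨ rank-transpose-between a<n n≤b ⟩
    rank f n k + 𝟙[ k ≤ f b ]          ≡⟨ cong (rank f n k +_) (𝟙-yes k≤fb) ⟩
    rank f n k + 1                     ≡⟨ +-comm (rank f n k) 1 ⟩
    suc (rank f n k)                   ∎
    where open ≡-Reasoning

  ≼-transpose : f a ≤ f b → f ≼ (f ∘ τ)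
  ≼-transpose fa≤fb n k with position a b n
  ... | inj₁ n≤a               = ≤-reflexive (sym (rank-transpose-below n≤a))
  ... | inj₂ (inj₂ b<n)        = ≤-reflexive (sym (rank-transpose-above b<n))
  ... | inj₂ (inj₁ (a<n , n≤b)) = +-cancelʳ-≤ 𝟙[ k ≤ f b ] (rank f n k) (rank (f ∘ τ) n k) (begin
    rank f n k + 𝟙[ k ≤ f b ]        ≡⟨ rank-transpose-between a<n n≤b ⟨
    rank (f ∘ τ) n k + 𝟙[ k ≤ f a ]  ≤⟨ +-monoʳ-≤ _ (𝟙-mono {k = k} (λ k≤fa → ≤-trans k≤fa fa≤fb)) ⟩
    rank (f ∘ τ) n k + 𝟙[ k ≤ f b ]  ∎)
    where open ≤-Reasoning

module _ {f g : ℕ → ℕ} {a : ℕ} (agree : ∀ {i} → i < a → f i ≡ g i) where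

  rank-gap : f a < k → k ≤ g a → (∀ {i} → a < i → i < n → k ≤ f i → g a < f i) →
             rank f n (suc (g a)) ≤ rank g n (suc (g a)) → a < n → rank f n k < rank g n k
  rank-gap {k} {n} fa<k k≤ga avoids-gap K-ranks a<n =
    +-cancelʳ-≤ (rank g n K) (suc (rank f n k)) (rank g n k) (begin
      suc (rank f n k) + rank g n K  ≤⟨ band a<n avoids-gap ⟩
      rank f n K + rank g n k        ≤⟨ +-monoˡ-≤ (rank g n k) K-ranks ⟩
      rank g n K + rank g n k        ≡⟨ +-comm (rank g n K) (rank g n k) ⟩
      rank g n k + rank g n K        ∎)
    where
    open ≤-Reasoning
    K : ℕ
    K = suc (g a)

    -- rank h n k ∸ rank h n K counts the i < n with k ≤ h i ≤ g a: g has such an i at a,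
    -- while f has none from a on.
    band : ∀ {n} → a < n → (∀ {i} → a < i → i < n → k ≤ f i → g a < f i) →
           suc (rank f n k) + rank g n K ≤ rank f n K + rank g n k
    band {suc n} (s≤s a≤n) avoids-gap with m≤n⇒m<n∨m≡n a≤n
    ... | inj₁ a<n =
      subst₂ _≤_ (interchange (suc (rank f n k)) (rank g n K) _ _)
                 (interchange (rank f n K) (rank g n k) _ _)
        (+-mono-≤ (band a<n (λ a<i i<n → avoids-gap a<i (m<n⇒m<1+n i<n)))
                  (+-mono-≤ (𝟙-mono (avoids-gap a<n ≤-refl)) (𝟙-mono (≤-trans (m≤n⇒m≤1+n k≤ga)))))
    ... | inj₂ refl = ≤-reflexive (begin-equality
      suc (rank f a k + 𝟙[ k ≤ f a ]) + (rank g a K + 𝟙[ K ≤ g a ])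
        ≡⟨ cong₂ (λ r s → suc r + s) (cong₂ _+_ (rank-cong agree) (𝟙-no fa<k))
                                     (cong (rank g a K +_) (𝟙-no {g a} ≤-refl)) ⟩
      suc (rank g a k + 0) + (rank g a K + 0)
        ≡⟨ +-comm (suc (rank g a k + 0)) (rank g a K + 0) ⟩
      (rank g a K + 0) + suc (rank g a k + 0)
        ≡⟨ cong ((rank g a K + 0) +_) (+-suc (rank g a k) 0) ⟨
      (rank g a K + 0) + (rank g a k + 1)
        ≡⟨ cong₂ _+_ (cong₂ _+_ (rank-cong agree) (𝟙-no (s≤s (<⇒≤ (<-≤-trans fa<k k≤ga)))))
                     (cong (rank g a k +_) (𝟙-yes k≤ga)) ⟨
      rank f a K + 𝟙[ K ≤ f a ] + (rank g a k + 𝟙[ k ≤ g a ]) ∎)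

module _ {f g : ℕ → ℕ} {a b : ℕ} (f≼g : f ≼ g) (agree : ∀ {i} → i < a → f i ≡ g i)
         (a<b : a < b) (fa<fb : f a < f b) (fb≤ga : f b ≤ g a)
         (avoids-gap : ∀ {i} → a < i → i < b → f a < f i → g a < f i) where

  private
    τ : ℕ → ℕ
    τ = transpose a b

  transpose-≼-between : a < n → n ≤ b → rank (f ∘ τ) n k ≤ rank g n k
  transpose-≼-between {n} {k} a<n n≤b with k ≤? f a | k ≤? f b
  ... | yes k≤fa | _ = subst (_≤ rank g n k)
    (sym (rank-transpose-between-≡ f a<b a<n n≤b
           (trans (𝟙-yes k≤fa) (sym (𝟙-yes (≤-trans k≤fa (<⇒≤ fa<fb)))))))
    (f≼g n k)
  ... | no k≰fa | no k≰fb = subst (_≤ rank g n k)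
    (sym (rank-transpose-between-≡ f a<b a<n n≤b
           (trans (𝟙-no (≰⇒> k≰fa)) (sym (𝟙-no (≰⇒> k≰fb))))))
    (f≼g n k)
  ... | no k≰fa | yes k≤fb = subst (_≤ rank g n k)
    (sym (rank-transpose-between-suc f a<b a<n n≤b (≰⇒> k≰fa) k≤fb))
    (rank-gap agree (≰⇒> k≰fa) (≤-trans k≤fb fb≤ga)
      (λ a<i i<n k≤fi → avoids-gap a<i (<-≤-trans i<n n≤b) (<-≤-trans (≰⇒> k≰fa) k≤fi))
      (f≼g n _) a<n)

  transpose-≼ : (f ∘ τ) ≼ g
  transpose-≼ n k with position a b n
  ... | inj₁ n≤a                = subst (_≤ rank g n k) (sym (rank-transpose-below f a<b n≤a)) (f≼g n k)
  ... | inj₂ (inj₂ b<n)         = subst (_≤ rank g n k) (sym (rank-transpose-above f a<b b<n)) (f≼g n k)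
  ... | inj₂ (inj₁ (a<n , n≤b)) = transpose-≼-between a<n n≤b

least : ∀ {p} {P : Pred ℕ p} → Decidable P → P n → ∃ λ m → P m × (∀ {i} → i < m → ¬ P i)
least {n} {P = P} P? = <-rec (λ n → P n → ∃ λ m → P m × (∀ {i} → i < m → ¬ P i)) search n
  where
  search : ∀ n → (∀ {m} → m < n → P m → ∃ λ m → P m × (∀ {i} → i < m → ¬ P i)) →
           P n → ∃ λ m → P m × (∀ {i} → i < m → ¬ P i)
  search n rec Pn with anyUpTo? P? n
  ... | yes (m , m<n , Pm) = rec m<n Pm
  ... | no  ∄m<n           = n , Pn , λ i<n Pi → ∄m<n (_ , i<n , Pi)

first-difference : f n ≢ g n → ∃ λ a → f a ≢ g a × (∀ {i} → i < a → f i ≡ g i)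
first-difference {f} {n} {g} fn≢gn with least (λ i → ¬? (f i ≟ g i)) fn≢gn
... | a , fa≢ga , below = a , fa≢ga , λ {i} i<a → decidable-stable (f i ≟ g i) (below i<a)

first-difference-≤ : f ≼ g → (∀ {i} → i < a → f i ≡ g i) → f a ≤ g a
first-difference-≤ {f} {g} {a} f≼g agree with f a ≤? g a
... | yes fa≤ga = fa≤ga
... | no  fa≰ga = contradiction (begin
  suc (rank g a (f a))                   ≡⟨ cong suc (rank-cong agree) ⟨
  suc (rank f a (f a))                   ≡⟨ +-comm 1 _ ⟩
  rank f a (f a) + 1                     ≡⟨ cong (rank f a (f a) +_) (𝟙-yes ≤-refl) ⟨
  rank f (suc a) (f a)                   ≤⟨ f≼g (suc a) (f a) ⟩
  rank g a (f a) + 𝟙[ f a ≤ g a ]        ≡⟨ cong (rank g a (f a) +_) (𝟙-no (≰⇒> fa≰ga)) ⟩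
  rank g a (f a) + 0                     ≡⟨ +-identityʳ _ ⟩
  rank g a (f a)                         ∎) 1+n≰n
  where open ≤-Reasoning

next-value-in-gap : ∀ {ν ω : S∞} → (∀ {i} → i < a → app ν i ≡ app ω i) → app ν a < app ω a →
  ∃ λ b → a < b × app ν a < app ν b × app ν b ≤ app ω a ×
          (∀ {i} → a < i → i < b → app ν a < app ν i → app ω a < app ν i)
next-value-in-gap {a} {ν} {ω} agree νa<ωa
  with least (λ i → (a <? i) ×-dec (app ν a <? app ν i) ×-dec (app ν i ≤? app ω a))
             (a<p , subst (app ν a <_) (sym νp≡ωa) νa<ωa , ≤-reflexive νp≡ωa)
  where
  open Bijection using (strictlySurjective; injective)
  p : ℕ
  p = proj₁ (strictlySurjective ν (app ω a))
  νp≡ωa : app ν p ≡ app ω a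
  νp≡ωa = proj₂ (strictlySurjective ν (app ω a))
  a<p : a < p
  a<p with <-cmp a p
  ... | tri< a<p _ _ = a<p
  ... | tri≈ _ a≡p _ = contradiction (trans (cong (app ν) a≡p) νp≡ωa) (<⇒≢ νa<ωa)
  ... | tri> _ _ p<a = contradiction (injective ω (trans (sym (agree p<a)) νp≡ωa)) (<⇒≢ p<a)
... | b , (a<b , νa<νb , νb≤ωa) , earliest =
  b , a<b , νa<νb , νb≤ωa , λ a<i i<b νa<νi → ≰⇒> (λ νi≤ωa → earliest i<b (a<i , νa<νi , νi≤ωa))

≤B-trans : ∀ {σ ν μ} → σ ≤B ν → ν ≤B μ → σ ≤B μ
≤B-trans σ≤ν ν≤μ n = transitive ≤-trans (σ≤ν n) (ν≤μ n)

≈∞-trans : ∀ {σ ν μ} → σ ≈∞ ν → ν ≈∞ μ → σ ≈∞ μ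
≈∞-trans (M , σ≡ν) (N , ν≡μ) = M ⊔ N , λ n M⊔N≤n →
  trans (σ≡ν n (m⊔n≤o⇒m≤o M N M⊔N≤n)) (ν≡μ n (m⊔n≤o⇒n≤o M N M⊔N≤n))

≐⇒≈∞ : ∀ {σ ν} → σ ≐ ν → σ ≈∞ ν
≐⇒≈∞ σ≐ν = 0 , λ n _ → σ≐ν n

≈∞-∘⟨⇄⟩ : ∀ ν a b → ν ≈∞ (ν ∘⟨ a ⇄ b ⟩)
≈∞-∘⟨⇄⟩ ν a b = suc (a ⊔ b) , λ n a⊔b<n → sym (cong (app ν)
  (transpose-≢ (>⇒≢ (≤-<-trans (m≤m⊔n a b) a⊔b<n)) (>⇒≢ (≤-<-trans (m≤n⊔m a b) a⊔b<n))))

step-towards : ∀ {ν ω} → ν ≤B ω → app ν n ≢ app ω n → ∃ λ μ → ν <B μ × μ ≤B ω × ν ≈∞ μ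
step-towards {ν = ν} {ω} ν≤ω νn≢ωn with first-difference νn≢ωn
... | a , νa≢ωa , agree with next-value-in-gap {ν = ν} {ω} agree νa<ωa
  where
  νa<ωa : app ν a < app ω a
  νa<ωa = ≤∧≢⇒< (first-difference-≤ (≤B⇒≼ {ν} {ω} ν≤ω) agree) νa≢ωa
... | b , a<b , νa<νb , νb≤ωa , avoids-gap =
  μ ,
  (≼⇒≤B {ν} {μ} (≼-transpose (app ν) a<b (<⇒≤ νa<νb)) ,
   λ ν≐μ → <⇒≢ νa<νb (trans (ν≐μ a) (cong (app ν) (transpose-ˡ a b)))) ,
  ≼⇒≤B {μ} {ω} (transpose-≼ (≤B⇒≼ {ν} {ω} ν≤ω) agree a<b νa<νb νb≤ωa avoids-gap) ,
  ≈∞-∘⟨⇄⟩ ν a b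
  where
  μ : S∞
  μ = ν ∘⟨ a ⇄ b ⟩

mainTheorem18 : (σ ω : S∞) → σ <B ω → ¬ (σ ≈∞ ω) → ¬ (∃ λ ν → IsMaximalIn σ ω ν)
mainTheorem18 σ ω _ σ≉ω (ν , (σ≤ν , ν≤ω , σ≈ν) , ν-maximal) =
  σ≉ω (≈∞-trans {σ} {ν} {ω} σ≈ν (≐⇒≈∞ {ν} {ω} ν≐ω))
  where
  ν≐ω : ν ≐ ω
  ν≐ω n = decidable-stable (app ν n ≟ app ω n) λ νn≢ωn →
    let μ , ν<μ , μ≤ω , ν≈μ = step-towards {ν = ν} {ω} ν≤ω νn≢ωn
    in  ν-maximal μ (≤B-trans {σ} {ν} {μ} σ≤ν (proj₁ ν<μ) , μ≤ω , ≈∞-trans {σ} {ν} {μ} σ≈ν ν≈μ) ν<μ
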